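{- Let $\boldsymbol{\pi}\in\mathfrak{S}_n$ be exactly $k$-stack-sortable. Then $\triangle:=\operatorname{conv}(\mathcal{S}^{\boldsymbol{\pi}})\subset\mathbb{R}^n$ is a $k$-simplex; that is, the $k+1$ points $\boldsymbol{\pi},s(\boldsymbol{\pi}),\dots,s^k(\boldsymbol{\pi})=\mathbf{e}$ are affinely independent.
   Context: Permutations $\boldsymbol{\pi}=\pi_1\cdots\pi_n\in\mathfrak{S}_n$ are identified with points $(\pi_1,\dots,\pi_n)\in\mathbb{R}^n$; $\mathbf{e}=12\cdots n$. The stack-sorting map $s$: start with an empty stack and read $\pi_1,\dots,\pi_n$ from left to right; for each $\pi_k$, while the stack is nonempty and its top element $t$ satisfies $t<\pi_k$, pop $t$ and append it to the output; then push $\pi_k$. After reading all entries, pop the remaining stack elements one by one to the output. The output is $s(\boldsymbol{\pi})$; $s^j$ is the $j$-fold iterate. $\boldsymbol{\pi}$ is exactly $k$-stack-sortable if $s^k(\boldsymbol{\pi})=\mathbf{e}$ and $s^j(\boldsymbol{\pi})\ne\mathbf{e}$ for $j<k$. $\mathcal{S}^{\boldsymbol{\pi}}=\{\boldsymbol{\pi},s(\boldsymbol{\pi}),\dots,s^k(\boldsymbol{\pi})=\mathbf{e}\}$, and $\operatorname{conv}(\mathcal{S}^{\boldsymbol{\pi}})$ is the stack-sorting polytope of $\boldsymbol{\pi}$.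
   Formalization: Affine independence of the points π, s(π), …, s^k(π) is tested only against affine dependences with rational coefficients rather than real ones. -}

module Defs where

open import Data.Nat using (ℕ; zero; suc; _<_; _<?_)
open import Data.Fin using (Fin)
import Data.Fin as Fin
open import Data.List using (List; []; _∷_; _++_; map; upTo)
open import Data.Product using (_×_; _,_)
open import Data.Rational using (ℚ; _+_; _*_; 0ℚ)
import Data.Rational as ℚ
import Data.Integer as ℤ
open import Relation.Nullary using (yes; no; ¬_)
open import Relation.Binary.PropositionalEquality using (_≡_)
open import Data.List.Relation.Binary.Permutation.Propositional using (_↭_)

e : ℕ → List ℕ
e n = map suc (upTo n)

IsPerm : ℕ → List ℕ → Set
IsPerm n π = π ↭ e n

-- pop the stack (head = top) while the top element t satisfies t < x;
-- returns (popped elements in output order, remaining stack)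
popWhile : ℕ → List ℕ → List ℕ × List ℕ
popWhile x [] = [] , []
popWhile x (t ∷ st) with t <? x
... | yes _ with popWhile x st
...   | out , rest = t ∷ out , rest
popWhile x (t ∷ st) | no _ = [] , t ∷ st

stackRun : List ℕ → List ℕ → List ℕ
stackRun stack [] = stack
stackRun stack (x ∷ xs) with popWhile x stack
... | out , rest = out ++ stackRun (x ∷ rest) xs

s : List ℕ → List ℕ
s π = stackRun [] π

s^ : ℕ → List ℕ → List ℕ
s^ zero π = π
s^ (suc j) π = s (s^ j π)

ExactlyStackSortable : ℕ → ℕ → List ℕ → Set
ExactlyStackSortable n k π = s^ k π ≡ e n × (∀ j → j < k → ¬ (s^ j π ≡ e n))

-- i-th coordinate (0-based) of a point given as a list, as a rational
coord : List ℕ → ℕ → ℚ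
coord [] i = 0ℚ
coord (x ∷ xs) zero = (ℤ.+ x) ℚ./ 1
coord (x ∷ xs) (suc i) = coord xs i

Σ : ∀ {m} → (Fin m → ℚ) → ℚ
Σ {zero} f = 0ℚ
Σ {suc m} f = f Fin.zero + Σ (λ j → f (Fin.suc j))

-- Stated over ℚ, which is
-- equivalent over ℝ for points with rational coordinates.
AffinelyIndependent : (n : ℕ) {m : ℕ} → (Fin m → List ℕ) → Set
AffinelyIndependent n {m} p =
  (c : Fin m → ℚ) → Σ c ≡ 0ℚ →
  (∀ i → i < n → Σ (λ j → c j * coord (p j) i) ≡ 0ℚ) →
  ∀ j → c j ≡ 0ℚ

-- Write an unsorted permutation as π = α (m+1) (m+2) ⋯ n with α ∈ 𝔖_m and m
-- minimal, so that the last entry of α is not m. One pass of stack-sorting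
-- carries the maximum m of α to the end of α, and from then on position m
-- (like every later position) stays a fixed point. Hence in any affine
-- dependence among π, s(π), …, s^k(π) the m-th coordinates force the
-- coefficient of π to vanish, and induction on s(π) finishes the argument.
module Submission where

open import Defs
open import Data.Nat using (ℕ; zero; suc; _<_; _<?_; _≟_; z<s; s<s)
open import Data.Nat.Properties using (suc-injective; n<1+n; m<n⇒m<1+n; <-asym)
open import Data.Fin using (Fin; toℕ)
import Data.Fin as Fin
open import Data.List using (List; []; _∷_; _++_; [_]; _∷ʳ_; length; map; upTo; initLast; _∷ʳ′_)
open import Data.List.Properties using (++-assoc; ++-identityʳ; ∷ʳ-++; map-++; length-map; length-upTo; upTo-∷ʳ)
open import Data.List.Relation.Unary.All using (All; []; _∷_)
import Data.List.Relation.Unary.All.Properties as AllP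
open import Data.List.Relation.Binary.Permutation.Propositional
  using (_↭_; ↭-refl; ↭-sym; ↭-trans; ↭-reflexive)
open import Data.List.Relation.Binary.Permutation.Propositional.Properties
  using (shift; ++⁺ˡ; ++⁺ʳ; drop-mid; drop-∷; ∷↭∷ʳ; All-resp-↭; ∈-resp-↭; ↭-empty-inv; ↭-length)
open import Data.List.Membership.Propositional using (_∈_)
open import Data.List.Membership.Propositional.Properties using (∈-∃++; ∈-++⁺ʳ)
open import Data.List.Relation.Unary.Any using (here)
open import Data.Product using (_×_; _,_; ∃; ∃₂; proj₁; proj₂)
open import Data.Empty using (⊥-elim)
open import Function using (_∘_)
open import Relation.Nullary using (yes; no; ¬_)
open import Relation.Binary.PropositionalEquality
  using (_≡_; _≢_; refl; sym; trans; cong; cong₂; subst; module ≡-Reasoning)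
import Data.Integer as ℤ
import Data.Integer.Properties as ℤ
open import Data.Rational using (ℚ; 0ℚ; 1ℚ; _+_; _-_; _*_; _/_)
import Data.Rational.Properties as ℚ
open import Data.Rational.Unnormalised using (mkℚᵘ; *≡*)
open import Data.Rational.Solver using (module +-*-Solver)

IsPerm-length : ∀ {n π} → IsPerm n π → length π ≡ n
IsPerm-length {n} p = trans (↭-length p) (trans (length-map suc (upTo n)) (length-upTo n))

IsPerm-bounded : ∀ {m α} → IsPerm m α → All (_< suc m) α
IsPerm-bounded {m} p =
  All-resp-↭ (↭-sym p) (AllP.map⁺ (AllP.applyUpTo⁺₁ (λ i → i) m s<s))

e-∷ʳ : ∀ m → e (suc m) ≡ e m ∷ʳ suc m
e-∷ʳ m = trans (cong (map suc) (sym (upTo-∷ʳ m))) (map-++ suc (upTo m) [ m ])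

∷ʳ-cancel-↭ : ∀ {xs ys : List ℕ} x → xs ∷ʳ x ↭ ys ∷ʳ x → xs ↭ ys
∷ʳ-cancel-↭ {xs} {ys} x p = drop-∷ (↭-trans (∷↭∷ʳ x xs) (↭-trans p (↭-sym (∷↭∷ʳ x ys))))

consecutive : ℕ → ℕ → List ℕ
consecutive a zero    = []
consecutive a (suc d) = suc a ∷ consecutive (suc a) d

popWhile-all : ∀ x st → All (_< x) st → popWhile x st ≡ (st , [])
popWhile-all x [] [] = refl
popWhile-all x (t ∷ st) (t<x ∷ st<x) with t <? x
... | yes _ rewrite popWhile-all x st st<x = refl
... | no t≮x = ⊥-elim (t≮x t<x)

popWhile-rest : ∀ {P : ℕ → Set} x st → All P st → All P (proj₂ (popWhile x st))
popWhile-rest x [] [] = []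
popWhile-rest x (t ∷ st) (pt ∷ pst) with t <? x
... | yes _ = popWhile-rest x st pst
... | no _  = pt ∷ pst

popWhile-split : ∀ x st → proj₁ (popWhile x st) ++ proj₂ (popWhile x st) ≡ st
popWhile-split x [] = refl
popWhile-split x (t ∷ st) with t <? x
... | yes _ = cong (t ∷_) (popWhile-split x st)
... | no _  = refl

popWhile-∷ʳ : ∀ x st M → ¬ M < x →
  popWhile x (st ∷ʳ M) ≡ (proj₁ (popWhile x st) , proj₂ (popWhile x st) ∷ʳ M)
popWhile-∷ʳ x [] M M≮x with M <? x
... | yes M<x = ⊥-elim (M≮x M<x)
... | no _    = refl
popWhile-∷ʳ x (t ∷ st) M M≮x with t <? x
... | yes _ rewrite popWhile-∷ʳ x st M M≮x = refl
... | no _  = refl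

stackRun-↭ : ∀ st xs → stackRun st xs ↭ st ++ xs
stackRun-↭ st [] = ↭-sym (↭-reflexive (++-identityʳ st))
stackRun-↭ st (x ∷ xs) with popWhile x st | popWhile-split x st
... | out , rest | refl =
  ↭-trans (++⁺ˡ out (stackRun-↭ (x ∷ rest) xs))
    (↭-trans (++⁺ˡ out (↭-sym (shift x rest xs))) (↭-reflexive (sym (++-assoc out rest (x ∷ xs)))))

s-↭ : ∀ π → s π ↭ π
s-↭ = stackRun-↭ []

-- A value larger than the stack and everything before it empties the stack
-- when it is read, so what comes before and after it is sorted separately.
stackRun-++-∷ : ∀ st α {x} γ → All (_< x) st → All (_< x) α →
  stackRun st (α ++ x ∷ γ) ≡ stackRun st α ++ stackRun [ x ] γ
stackRun-++-∷ st [] {x} γ st<x [] rewrite popWhile-all x st st<x = refl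
stackRun-++-∷ st (y ∷ α) γ st<x (y<x ∷ α<x) with popWhile y st | popWhile-rest y st st<x
... | out , rest | rest<x rewrite stackRun-++-∷ (y ∷ rest) α γ (y<x ∷ rest<x) α<x =
  sym (++-assoc out (stackRun (y ∷ rest) α) _)

stackRun-consecutive : ∀ a d → stackRun [ a ] (consecutive a d) ≡ a ∷ consecutive a d
stackRun-consecutive a zero = refl
stackRun-consecutive a (suc d) rewrite popWhile-all (suc a) [ a ] (n<1+n a ∷ []) =
  cong (a ∷_) (stackRun-consecutive (suc a) d)

s-++-consecutive : ∀ α m d → All (_< suc m) α → s (α ++ consecutive m d) ≡ s α ++ consecutive m d
s-++-consecutive α m zero _ rewrite ++-identityʳ α | ++-identityʳ (s α) = refl
s-++-consecutive α m (suc d) α≤m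
  rewrite stackRun-++-∷ [] α (consecutive (suc m) d) [] α≤m | stackRun-consecutive (suc m) d = refl

stackRun-∷ʳ-max : ∀ st M γ → All (_< M) st → All (_< M) γ →
  ∃ λ X → stackRun (st ∷ʳ M) γ ≡ X ∷ʳ M
stackRun-∷ʳ-max st M [] _ [] = st , refl
stackRun-∷ʳ-max st M (y ∷ γ) st<M (y<M ∷ γ<M) rewrite popWhile-∷ʳ y st M (<-asym y<M)
  with popWhile y st | popWhile-rest y st st<M
... | out , rest | rest<M with stackRun-∷ʳ-max (y ∷ rest) M γ (y<M ∷ rest<M) γ<M
...   | X , eq = out ++ X , trans (cong (out ++_) eq) (sym (++-assoc out X [ M ]))

s-max-last : ∀ m α → IsPerm (suc m) α → ∃ λ X → s α ≡ X ∷ʳ suc m × IsPerm m X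
s-max-last m α p with ∈-∃++ (∈-resp-↭ (↭-sym p) (subst (suc m ∈_) (sym (e-∷ʳ m)) (∈-++⁺ʳ (e m) (here refl))))
... | β , γ , refl = s β ++ Y , sα≡ , ∷ʳ-cancel-↭ (suc m) sα↭
  where
  p′ : β ++ [ suc m ] ++ γ ↭ e m ++ [ suc m ] ++ []
  p′ = subst (β ++ [ suc m ] ++ γ ↭_) (e-∷ʳ m) p
  βγ<M : All (_< suc m) (β ++ γ)
  βγ<M = IsPerm-bounded (↭-trans (drop-mid β (e m) p′) (↭-reflexive (++-identityʳ (e m))))
  γ-run : ∃ λ Y → stackRun [ suc m ] γ ≡ Y ∷ʳ suc m
  γ-run = stackRun-∷ʳ-max [] (suc m) γ [] (AllP.++⁻ʳ β βγ<M)
  Y : List ℕ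
  Y = proj₁ γ-run
  sα≡ : s (β ++ suc m ∷ γ) ≡ (s β ++ Y) ∷ʳ suc m
  sα≡ = let open ≡-Reasoning in begin
    s (β ++ suc m ∷ γ)          ≡⟨ stackRun-++-∷ [] β γ [] (AllP.++⁻ˡ β βγ<M) ⟩
    s β ++ stackRun [ suc m ] γ ≡⟨ cong (s β ++_) (proj₂ γ-run) ⟩
    s β ++ Y ∷ʳ suc m           ≡⟨ sym (++-assoc (s β) Y [ suc m ]) ⟩
    (s β ++ Y) ∷ʳ suc m         ∎
  sα↭ : (s β ++ Y) ∷ʳ suc m ↭ e m ∷ʳ suc m
  sα↭ = ↭-trans (↭-reflexive (sym sα≡)) (↭-trans (s-↭ _) p′)

FixedTail : List ℕ → ℕ → ℕ → Set
FixedTail π m d = ∃ λ α → IsPerm m α × π ≡ α ++ consecutive m d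

FixedTail-grow : ∀ {π m d} → FixedTail π m (suc d) → FixedTail π (suc m) d
FixedTail-grow {m = m} {d} (α , p , π≡) =
  α ∷ʳ suc m , subst (α ∷ʳ suc m ↭_) (sym (e-∷ʳ m)) (++⁺ʳ [ suc m ] p) ,
  trans π≡ (sym (∷ʳ-++ α (suc m) (consecutive (suc m) d)))

s-FixedTail-shrink : ∀ {π m d} → FixedTail π (suc m) d → FixedTail (s π) m (suc d)
s-FixedTail-shrink {m = m} {d} (α , p , refl) with s-max-last m α p
... | X , sα≡ , X↭ = X , X↭ , (let open ≡-Reasoning in begin
  s (α ++ consecutive (suc m) d)       ≡⟨ s-++-consecutive α (suc m) d (IsPerm-bounded p) ⟩
  s α ++ consecutive (suc m) d         ≡⟨ cong (_++ consecutive (suc m) d) sα≡ ⟩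
  X ∷ʳ suc m ++ consecutive (suc m) d  ≡⟨ ∷ʳ-++ X (suc m) (consecutive (suc m) d) ⟩
  X ++ consecutive m (suc d)           ∎)

s-FixedTail : ∀ {π} m {d} → FixedTail π m d → FixedTail (s π) m d
s-FixedTail zero {d} (α , p , refl) with ↭-empty-inv p
... | refl = [] , ↭-refl , s-++-consecutive [] 0 d []
s-FixedTail (suc m) tail = FixedTail-grow (s-FixedTail-shrink tail)

s^-FixedTail : ∀ {π m d} → FixedTail π (suc m) d → ∀ j → FixedTail (s^ (suc j) π) m (suc d)
s^-FixedTail tail zero    = s-FixedTail-shrink tail
s^-FixedTail tail (suc j) = s-FixedTail _ (s^-FixedTail tail j)

fromℕ : ℕ → ℚ
fromℕ k = ℤ.+ k / 1

fromℕ-injective : ∀ {a b} → fromℕ a ≡ fromℕ b → a ≡ b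
fromℕ-injective {a} {b} eq with ℚ./-injective-≃ (mkℚᵘ (ℤ.+ a) 0) (mkℚᵘ (ℤ.+ b) 0) eq
... | *≡* a*1≡b*1 = ℤ.+-injective (trans (sym (ℤ.*-identityʳ _)) (trans a*1≡b*1 (ℤ.*-identityʳ _)))

coord-++-∷ : ∀ α {m x γ} → length α ≡ m → coord (α ++ x ∷ γ) m ≡ fromℕ x
coord-++-∷ []      refl = refl
coord-++-∷ (_ ∷ α) refl = coord-++-∷ α refl

FixedTail-coord : ∀ {π m d} → FixedTail π m (suc d) → coord π m ≡ fromℕ (suc m)
FixedTail-coord (α , p , refl) = coord-++-∷ α (IsPerm-length p)

-- Peel trailing fixed points off α until its last entry is not a fixed point;
-- α ≠ e m guarantees that this stops before α is empty.
lastUnfixed : ∀ m {d π α} → IsPerm m α → π ≡ α ++ consecutive m d → α ≢ e m →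
  ∃₂ λ q d′ → q < m × FixedTail π (suc q) d′ × coord π q ≢ fromℕ (suc q)
lastUnfixed zero p _ α≢e = ⊥-elim (α≢e (↭-empty-inv p))
lastUnfixed (suc m) {α = α} p π≡ α≢e with initLast α
lastUnfixed (suc m) p π≡ α≢e | [] with ↭-empty-inv (↭-sym p)
... | ()
lastUnfixed (suc m) {d} {π} p π≡ α≢e | β ∷ʳ′ x with x ≟ suc m
... | yes refl =
  let q , d′ , q<m , rest = lastUnfixed m β↭ (trans π≡ (∷ʳ-++ β (suc m) _)) β≢e
  in q , d′ , m<n⇒m<1+n q<m , rest
  where
  β↭ : IsPerm m β
  β↭ = ∷ʳ-cancel-↭ (suc m) (subst (β ∷ʳ suc m ↭_) (e-∷ʳ m) p)
  β≢e : β ≢ e m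
  β≢e β≡e = α≢e (trans (cong (_∷ʳ suc m) β≡e) (sym (e-∷ʳ m)))
... | no x≢ = m , d , n<1+n m , (β ∷ʳ x , p , π≡) ,
  λ eq → x≢ (fromℕ-injective (trans (sym coord≡x) eq))
  where
  coord≡x : coord π m ≡ fromℕ x
  coord≡x = trans (cong (λ σ → coord σ m) (trans π≡ (∷ʳ-++ β x _)))
    (coord-++-∷ β (suc-injective (IsPerm-length (↭-trans (∷↭∷ʳ x β) p))))

unsorted-witness : ∀ {n π} → IsPerm n π → π ≢ e n →
  ∃ λ q → q < n × coord π q ≢ fromℕ (suc q) × ∀ j → coord (s^ (suc j) π) q ≡ fromℕ (suc q)
unsorted-witness {π = π} p π≢e with lastUnfixed _ p (sym (++-identityʳ π)) π≢e
... | q , _ , q<n , tail , π≢ = q , q<n , π≢ , λ j → FixedTail-coord (s^-FixedTail tail j)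

Σ-cong : ∀ {m} {f g : Fin m → ℚ} → (∀ j → f j ≡ g j) → Σ f ≡ Σ g
Σ-cong {zero}  f≡g = refl
Σ-cong {suc m} f≡g = cong₂ _+_ (f≡g Fin.zero) (Σ-cong (f≡g ∘ Fin.suc))

Σ-distribʳ : ∀ {m} (c : Fin m → ℚ) a → Σ (λ j → c j * a) ≡ Σ c * a
Σ-distribʳ {zero}  c a = sym (ℚ.*-zeroˡ a)
Σ-distribʳ {suc m} c a = trans (cong (c Fin.zero * a +_) (Σ-distribʳ (c ∘ Fin.suc) a))
  (sym (ℚ.*-distribʳ-+ a (c Fin.zero) (Σ (c ∘ Fin.suc))))

p*[q-r]≡0⇒p≡0 : ∀ {p q r} → q ≢ r → p * (q - r) ≡ 0ℚ → p ≡ 0ℚ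
p*[q-r]≡0⇒p≡0 {p} {q} {r} q≢r p*[q-r]≡0 with ℚ.#⇒invertible q≢r
... | t , _ , [q-r]*t≡1 = let open ≡-Reasoning in begin
  p                   ≡⟨ sym (ℚ.*-identityʳ p) ⟩
  p * 1ℚ              ≡⟨ cong (p *_) (sym [q-r]*t≡1) ⟩
  p * ((q - r) * t)   ≡⟨ sym (ℚ.*-assoc p (q - r) t) ⟩
  p * (q - r) * t     ≡⟨ cong (_* t) p*[q-r]≡0 ⟩
  0ℚ * t              ≡⟨ ℚ.*-zeroˡ t ⟩
  0ℚ                  ∎

affinelyIndependent-singleton : ∀ n (p : Fin 1 → List ℕ) → AffinelyIndependent n p
affinelyIndependent-singleton n p c Σc≡0 _ Fin.zero = trans (sym (ℚ.+-identityʳ (c Fin.zero))) Σc≡0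

affinelyIndependent-cong : ∀ n {m} {p q : Fin m → List ℕ} → (∀ j → p j ≡ q j) →
  AffinelyIndependent n p → AffinelyIndependent n q
affinelyIndependent-cong n p≡q indep c Σc≡0 comb≡0 =
  indep c Σc≡0 (λ i i<n → trans (Σ-cong (λ j → cong (λ σ → c j * coord σ i) (p≡q j))) (comb≡0 i i<n))

affinelyIndependent-extend : ∀ n {m i a} (p : Fin (suc m) → List ℕ) → i < n →
  coord (p Fin.zero) i ≢ a → (∀ j → coord (p (Fin.suc j)) i ≡ a) →
  AffinelyIndependent n (p ∘ Fin.suc) → AffinelyIndependent n p
affinelyIndependent-extend n {i = i} {a} p i<n x≢a tail≡a indep c Σc≡0 comb≡0 = λ where
    Fin.zero    → c₀≡0
    (Fin.suc j) → indep (c ∘ Fin.suc) (drop-zero c₀≡0 Σc≡0) tail-comb≡0 j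
  where
  c₀ S x : ℚ
  c₀ = c Fin.zero
  S  = Σ (c ∘ Fin.suc)
  x  = coord (p Fin.zero) i

  drop-zero : ∀ {u T} → u ≡ 0ℚ → u + T ≡ 0ℚ → T ≡ 0ℚ
  drop-zero {T = T} refl 0+T≡0 = trans (sym (ℚ.+-identityˡ T)) 0+T≡0

  c₀x+Sa≡0 : c₀ * x + S * a ≡ 0ℚ
  c₀x+Sa≡0 = trans (cong (c₀ * x +_) (sym (trans
    (Σ-cong (λ j → cong (c (Fin.suc j) *_) (tail≡a j))) (Σ-distribʳ (c ∘ Fin.suc) a))))
    (comb≡0 i i<n)

  c₀≡0 : c₀ ≡ 0ℚ
  c₀≡0 = p*[q-r]≡0⇒p≡0 x≢a (let open ≡-Reasoning in begin
    c₀ * (x - a)                        ≡⟨ identity c₀ S x a ⟩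
    (c₀ * x + S * a) - (c₀ + S) * a     ≡⟨ cong₂ (λ u v → u - v * a) c₀x+Sa≡0 Σc≡0 ⟩
    0ℚ - 0ℚ * a                         ≡⟨ cong (0ℚ -_) (ℚ.*-zeroˡ a) ⟩
    0ℚ                                  ∎)
    where
    open +-*-Solver
    identity : ∀ c S x a → c * (x - a) ≡ (c * x + S * a) - (c + S) * a
    identity = solve 4 (λ c S x a → c :* (x :- a) := (c :* x :+ S :* a) :- (c :+ S) :* a) refl

  tail-comb≡0 : ∀ i′ → i′ < n → Σ (λ j → c (Fin.suc j) * coord (p (Fin.suc j)) i′) ≡ 0ℚ
  tail-comb≡0 i′ i′<n =
    drop-zero (trans (cong (_* coord (p Fin.zero) i′) c₀≡0) (ℚ.*-zeroˡ (coord (p Fin.zero) i′)))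
      (comb≡0 i′ i′<n)

s^-s : ∀ j π → s^ j (s π) ≡ s^ (suc j) π
s^-s zero    π = refl
s^-s (suc j) π = cong s (s^-s j π)

exactlyStackSortable-s : ∀ {n k π} → ExactlyStackSortable n (suc k) π → ExactlyStackSortable n k (s π)
exactlyStackSortable-s {k = k} {π} (sorted , unsorted) =
  trans (s^-s k π) sorted , λ j j<k eq → unsorted (suc j) (s<s j<k) (trans (sym (s^-s j π)) eq)

theorem3p3 : (n k : ℕ) (π : List ℕ) → IsPerm n π → ExactlyStackSortable n k π →
    AffinelyIndependent n {suc k} (λ j → s^ (toℕ j) π)
theorem3p3 n zero    π _ _ = affinelyIndependent-singleton n (λ j → s^ (toℕ j) π)
theorem3p3 n (suc k) π p sortable@(_ , unsorted)
  with unsorted-witness p (unsorted 0 z<s)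
... | q , q<n , π≢ , iterates≡ =
  affinelyIndependent-extend n (λ j → s^ (toℕ j) π) q<n π≢ (iterates≡ ∘ toℕ)
    (affinelyIndependent-cong n (λ j → s^-s (toℕ j) π)
      (theorem3p3 n k (s π) (↭-trans (s-↭ π) p) (exactlyStackSortable-s sortable)))
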